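{- Let $k\ge2$, $n\in\mathbb{N}$ and $w\in S_n$. Then the descent set of $\mathcal{C}_{k,n,w}$ equals \[\bigcup_{s\in\operatorname{supp}(c_w)}\left\{\sum_{i=1}^{s}d_ik^{n-i} : d_s\in[k-1]\text{ and } d_i\in\{0,1,\dots,k-1\}\text{ for all } i\in[s-1]\right\}.\]
   Context: The infinite rooted directed $k$-ary tree has a root on layer $1$; every vertex has $k$ children, ordered left to right, on the next layer. A vertex with at least $k$ chips may fire by choosing $k$ of its labeled chips and sending the $j$th smallest to its $j$th leftmost child. Chips $0,\dots,k^n-1$ start at the root and are written in $n$-digit $k$-ary expansion. For $w\in S_n$, the strategy $F_w$ fires, for each $i\in[n]$, each vertex $v$ on layer $i$ so that all chips on $v$ whose $w_i$th most significant digit equals $j$ go to the $(j+1)$th leftmost child of $v$. $\mathcal{C}_{k,n,w}=(\pi_1,\dots,\pi_{k^n})$ is the resulting stable configuration, read as the sequence of chips on layer $n+1$ from left to right; its descent set is $\{i\in[k^n-1]:\pi_i>\pi_{i+1}\}$. The Lehmer code of $w$ is $c_w$ with $(c_w)_i=\#\{j>i:w_j<w_i\}$, and $\operatorname{supp}(c_w)=\{i\in[n]:(c_w)_i>0\}$. -}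

module Defs where

open import Data.Nat using (ℕ; zero; suc; _+_; _*_; _∸_; _^_; _<_; _≤_; NonZero; _≟_; >-nonZero; s≤s; z≤n)
open import Data.Nat.DivMod using (_/_; _%_)
open import Data.Nat.Properties using (m^n≢0; ≤-trans)
open import Data.Fin using (Fin; toℕ) renaming (_<_ to _<ᶠ_; _<?_ to _<ᶠ?_)
open import Data.Fin.Permutation using (Permutation′; _⟨$⟩ʳ_)
open import Data.List using (List; []; _∷_; map; filter; concatMap; upTo; foldl; concat; length)
open import Data.List.Base using (allFin)
open import Data.Product using (_×_)
open import Data.Empty using (⊥)
open import Relation.Nullary using (Dec)
open import Relation.Nullary.Decidable using (_×-dec_)

-- A permutation w ∈ S_n, with positions and values 0-indexed:
-- the paper's w_i (1-indexed) corresponds to  toℕ (w ⟨$⟩ʳ (i-1)) + 1.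
Perm : ℕ → Set
Perm n = Permutation′ n

-- The p-th (0-indexed, so the paper's (p+1)-th) most significant digit of the
-- n-digit base-k expansion of c.
digit : (k : ℕ) → .{{NonZero k}} → (n : ℕ) → ℕ → ℕ → ℕ
digit k n p c = (_/_ c (k ^ (n ∸ suc p)) {{m^n≢0 k (n ∸ suc p)}}) % k

-- A layer of the tree: the list of its vertices from left to right, each vertex
-- given by the list of chips on it.
Layer : Set
Layer = List (List ℕ)

fireLayer : (k : ℕ) → .{{NonZero k}} → (n p : ℕ) → Layer → Layer
fireLayer k n p vs =
  concatMap (λ v → map (λ j → filter (λ c → digit k n p c ≟ j) v) (upTo k)) vs

-- The stable configuration C_{k,n,w}: start with chips 0..k^n-1 at the root,
-- fire layer i (i = 1..n) according to digit w_i, and read off layer n+1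
-- from left to right (concatenating the chips of its vertices, which are
-- singletons).
config : (k : ℕ) → .{{NonZero k}} → (n : ℕ) → Perm n → List ℕ
config k n w =
  concat (foldl (λ vs i → fireLayer k n (toℕ (w ⟨$⟩ʳ i)) vs)
                ((upTo (k ^ n)) ∷ [])
                (allFin n))

-- Descent (1-indexed): IsDescent π m  iff  1 ≤ m < length π and π_m > π_{m+1}.
IsDescent : List ℕ → ℕ → Set
IsDescent (x ∷ y ∷ xs) (suc zero) = y < x
IsDescent (x ∷ xs) (suc (suc m)) = IsDescent xs (suc m)
IsDescent _ _ = ⊥

lehmer : {n : ℕ} → Perm n → Fin n → ℕ
lehmer {n} w i =
  length (filter (λ j → (i <ᶠ? j) ×-dec ((w ⟨$⟩ʳ j) <ᶠ? (w ⟨$⟩ʳ i))) (allFin n))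

sumTo : ℕ → (ℕ → ℕ) → ℕ
sumTo zero f = 0
sumTo (suc m) f = sumTo m f + f m

2≤⇒nonZero : {k : ℕ} → 2 ≤ k → NonZero k
2≤⇒nonZero hk = >-nonZero (≤-trans (s≤s z≤n) hk)

{-# OPTIONS --safe #-}
module Submission where

-- Firing layer i by the digit at position w i sends a chip c to the leaf whose base-k
-- digits, read from the top, are the digits of c at positions w 1, …, w n.  Hence leaf v
-- carries the chip π v whose digit at position w i is the i-th digit of v, and
-- C_{k,n,w} = (π 0, …, π (kⁿ − 1)).  If s is
-- the position of the last nonzero digit of m, then m − 1 has the same digits as m before
-- s, digit d_s − 1 at s and k − 1 after s.  So π m and π (m − 1) first differ at
-- p = min {w j ∣ j ≥ s}: if the minimum is w s the digit of π m there is the larger one,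
-- otherwise it is attained at some j > s with w j < w s and the digit of π m there is
-- 0 < k − 1.  Thus m is a descent iff some j > s has w j < w s, i.e. (c_w)_s > 0, and
-- the m whose last nonzero digit is at s are exactly the sums in the statement.

open import Defs
open import Data.Nat
open import Data.Nat.Properties
open import Data.Nat.DivMod
open import Data.Nat.Divisibility using (_∣_; divides; divides-refl)
open import Data.Nat.Solver using (module +-*-Solver)
open import Data.Fin as Fin using (Fin; zero; suc; toℕ; fromℕ<; inject)
open import Data.Fin.Properties as Finₚ
  using (toℕ-fromℕ<; fromℕ<-toℕ; toℕ<n; toℕ-injective; toℕ-inject; all?; ¬∀⟶∃¬-smallest)
open import Data.Fin.Permutation using (_⟨$⟩ʳ_; _⟨$⟩ˡ_; inverseˡ; inverseʳ)
open import Data.List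
open import Data.List.Properties
import Data.List.Relation.Unary.All as All
open import Data.List.Relation.Unary.All.Properties using (applyUpTo⁺₁)
open import Data.List.Relation.Unary.Any as Any using (Any; here; there)
open import Data.List.Membership.Propositional using (lose)
open import Data.List.Membership.Propositional.Properties using (∈-allFin)
open import Data.Product using (Σ; ∃; _×_; _,_)
open import Data.Sum using (_⊎_; inj₁; inj₂)
open import Function using (id; _∘_; _$_)
open import Function.Bundles using (_⇔_; mk⇔; Equivalence)
open import Function.Properties.Equivalence using (⇔-setoid) renaming (trans to ⇔-trans)
open import Level using (0ℓ)
open import Relation.Binary using (tri<; tri≈; tri>)
import Relation.Binary.Reasoning.Setoid as SetoidReasoning
open import Relation.Binary.PropositionalEquality
  using (_≡_; _≢_; refl; sym; trans; cong; cong₂; subst; subst₂; module ≡-Reasoning)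
open import Relation.Nullary using (¬_; yes; no; contradiction)
open import Relation.Nullary.Decidable using (_×-dec_)
open import Relation.Unary using (Pred; Decidable; _≐_)
open import Relation.Unary.Properties using (_∩?_)

module _ {A : Set} {P Q : Pred A 0ℓ} (P? : Decidable P) (Q? : Decidable Q) where

  filter-filter : ∀ xs → filter P? (filter Q? xs) ≡ filter (Q? ∩? P?) xs
  filter-filter []       = refl
  filter-filter (x ∷ xs) with Q? x
  ... | no _ = filter-filter xs
  ... | yes _ with P? x
  ...   | yes _ = cong (x ∷_) (filter-filter xs)
  ...   | no _  = filter-filter xs

module _ {A : Set} {P : Pred A 0ℓ} (P? : Decidable P) where

  filter-nonempty⇒Any : ∀ xs → 0 < length (filter P? xs) → Any P xs
  filter-nonempty⇒Any (x ∷ xs) nonempty with P? x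
  ... | yes px = here px
  ... | no _   = there (filter-nonempty⇒Any xs nonempty)

module _ {P : Pred ℕ 0ℓ} (P? : Decidable P) where

  filter-upTo-unique : ∀ {c} N → c < N → (∀ {x} → x < N → P x ⇔ x ≡ c) →
                       filter P? (upTo N) ≡ [ c ]
  filter-upTo-unique {c} (suc N) c<1+N P⇔≡c = begin
    filter P? (upTo (suc N))              ≡⟨ cong (filter P?) (upTo-∷ʳ N) ⟨
    filter P? (upTo N ++ [ N ])           ≡⟨ filter-++ P? (upTo N) [ N ] ⟩
    filter P? (upTo N) ++ filter P? [ N ] ≡⟨ last-or-earlier (m≤n⇒m<n∨m≡n (s≤s⁻¹ c<1+N)) ⟩
    [ c ]                                 ∎
    where
    open ≡-Reasoning
    P⇒≡c : ∀ {x} → x < suc N → P x → x ≡ c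
    P⇒≡c x<1+N = Equivalence.to (P⇔≡c x<1+N)
    last-or-earlier : c < N ⊎ c ≡ N → filter P? (upTo N) ++ filter P? [ N ] ≡ [ c ]
    last-or-earlier (inj₁ c<N) = cong₂ _++_
      (filter-upTo-unique N c<N (P⇔≡c ∘ m<n⇒m<1+n))
      (filter-reject P? λ PN → <-irrefl (sym (P⇒≡c ≤-refl PN)) c<N)
    last-or-earlier (inj₂ refl) = cong₂ _++_
      (filter-none P? (applyUpTo⁺₁ id N λ x<N Px → <-irrefl (P⇒≡c (m<n⇒m<1+n x<N) Px) x<N))
      (filter-accept P? (Equivalence.from (P⇔≡c ≤-refl) refl))

applyUpTo-cong : ∀ {A : Set} {f g : ℕ → A} n → (∀ {i} → i < n → f i ≡ g i) →
                 applyUpTo f n ≡ applyUpTo g n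
applyUpTo-cong zero    f≗g = refl
applyUpTo-cong (suc n) f≗g = cong₂ _∷_ (f≗g z<s) (applyUpTo-cong n (f≗g ∘ s<s))

module _ {A : Set} where

  applyUpTo-++ : ∀ (f : ℕ → A) m n →
                 applyUpTo f (m + n) ≡ applyUpTo f m ++ applyUpTo (f ∘ (m +_)) n
  applyUpTo-++ f zero    n = refl
  applyUpTo-++ f (suc m) n = cong (f 0 ∷_) (applyUpTo-++ (f ∘ suc) m n)

  applyUpTo-blocks : ∀ (f : ℕ → A) k N →
    applyUpTo f (N * k) ≡ concat (applyUpTo (λ v → applyUpTo (λ j → f (v * k + j)) k) N)
  applyUpTo-blocks f k zero    = refl
  applyUpTo-blocks f k (suc N) = begin
    applyUpTo f (k + N * k)
      ≡⟨ applyUpTo-++ f k (N * k) ⟩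
    applyUpTo f k ++ applyUpTo (f ∘ (k +_)) (N * k)
      ≡⟨ cong (applyUpTo f k ++_) (applyUpTo-blocks (f ∘ (k +_)) k N) ⟩
    applyUpTo f k ++ concat (applyUpTo (λ v → applyUpTo (λ j → f (k + (v * k + j))) k) N)
      ≡⟨ cong (λ blocks → applyUpTo f k ++ concat blocks) (applyUpTo-cong N λ {v} _ →
           applyUpTo-cong k λ {j} _ → cong f (sym (+-assoc k (v * k) j))) ⟩
    concat (applyUpTo (λ v → applyUpTo (λ j → f (v * k + j)) k) (suc N)) ∎
    where open ≡-Reasoning

IsDescent-applyUpTo : ∀ (f : ℕ → ℕ) N m →
  IsDescent (applyUpTo f N) m ⇔ (∃ λ m₀ → m ≡ suc m₀ × m < N × f m < f m₀)
IsDescent-applyUpTo f N m = mk⇔ (to f N m) (from f N m)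
  where
  to : ∀ f N m → IsDescent (applyUpTo f N) m → ∃ λ m₀ → m ≡ suc m₀ × m < N × f m < f m₀
  to f (suc (suc N)) 1             fall = 0 , refl , s<s z<s , fall
  to f (suc (suc N)) (suc (suc m)) fall with to (f ∘ suc) (suc N) (suc m) fall
  ... | m₀ , refl , m<N , fall′ = suc m₀ , refl , s<s m<N , fall′
  to f 1             0             ()
  to f 1             1             ()
  to f 1             (suc (suc m)) ()
  to f (suc (suc N)) 0             ()
  from : ∀ f N m → (∃ λ m₀ → m ≡ suc m₀ × m < N × f m < f m₀) → IsDescent (applyUpTo f N) m
  from f (suc (suc N)) 1             (_ , refl , _ , fall)         = fall
  from f (suc (suc N)) (suc (suc m)) (_ , refl , s<s m<N , fall) =
    from (f ∘ suc) (suc N) (suc m) (m , refl , m<N , fall)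
  from f 1             1             (_ , refl , s<s () , _)
  from f 1             (suc (suc m)) (_ , refl , s<s () , _)

∃-Fin⇔∃-< : ∀ {n} (P : Fin n → Set) (Q : ℕ → Set) →
  (∃ λ s → Σ (s < n) λ s<n → P (fromℕ< s<n) × Q s) ⇔ (∃ λ (s : Fin n) → P s × Q (toℕ s))
∃-Fin⇔∃-< P Q = mk⇔
  (λ (s , s<n , p , q) → fromℕ< s<n , p , subst Q (sym (toℕ-fromℕ< s<n)) q)
  (λ (s , p , q) → toℕ s , toℕ<n s , subst P (sym (fromℕ<-toℕ s (toℕ<n s))) p , q)

sumTo-cong : ∀ {f g : ℕ → ℕ} n → (∀ {i} → i < n → f i ≡ g i) → sumTo n f ≡ sumTo n g
sumTo-cong zero    f≗g = refl
sumTo-cong (suc n) f≗g = cong₂ _+_ (sumTo-cong n (f≗g ∘ m<n⇒m<1+n)) (f≗g ≤-refl)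

sumTo-unfoldˡ : ∀ f n → sumTo (suc n) f ≡ f 0 + sumTo n (f ∘ suc)
sumTo-unfoldˡ f zero    = sym (+-identityʳ (f 0))
sumTo-unfoldˡ f (suc n) =
  trans (cong (_+ f (suc n)) (sumTo-unfoldˡ f n)) (+-assoc (f 0) _ (f (suc n)))

sumTo-vanishing-tail : ∀ {f m n} → m ≤ n → (∀ {i} → m ≤ i → i < n → f i ≡ 0) →
                       sumTo n f ≡ sumTo m f
sumTo-vanishing-tail {f} m≤n = go (≤⇒≤′ m≤n)
  where
  go : ∀ {m n} → m ≤′ n → (∀ {i} → m ≤ i → i < n → f i ≡ 0) → sumTo n f ≡ sumTo m f
  go ≤′-refl                     _      = refl
  go {m} {suc n} (≤′-step m≤′n) vanish = begin
    sumTo n f + f n ≡⟨ cong (sumTo n f +_) (vanish (≤′⇒≤ m≤′n) ≤-refl) ⟩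
    sumTo n f + 0   ≡⟨ +-identityʳ _ ⟩
    sumTo n f       ≡⟨ go m≤′n (λ m≤i i<n → vanish m≤i (m<n⇒m<1+n i<n)) ⟩
    sumTo m f       ∎
    where open ≡-Reasoning

truncate : ℕ → (ℕ → ℕ) → ℕ → ℕ
truncate s d i with i ≤? s
... | yes _ = d i
... | no _  = 0

truncate-≤ : ∀ {s d i} → i ≤ s → truncate s d i ≡ d i
truncate-≤ {s} {d} {i} i≤s with i ≤? s
... | yes _  = refl
... | no i≰s = contradiction i≤s i≰s

truncate-> : ∀ {s d i} → s < i → truncate s d i ≡ 0
truncate-> {s} {d} {i} s<i with i ≤? s
... | yes i≤s = contradiction s<i (≤⇒≯ i≤s)
... | no _    = refl

m*n+o<[1+m]*n : ∀ m {n o} → o < n → m * n + o < suc m * n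
m*n+o<[1+m]*n m {n} {o} o<n = subst (m * n + o <_) (+-comm (m * n) n) (+-monoʳ-< (m * n) o<n)

[m*d+r]/d≡m : ∀ m {d r} .{{_ : NonZero d}} → r < d → (m * d + r) / d ≡ m
[m*d+r]/d≡m m {d} {r} r<d = begin
  (m * d + r) / d   ≡⟨ +-distrib-/-∣ˡ r (divides-refl m) ⟩
  m * d / d + r / d ≡⟨ cong₂ _+_ (m*n/n≡m m d) (m<n⇒m/n≡0 r<d) ⟩
  m + 0             ≡⟨ +-identityʳ m ⟩
  m                 ∎
  where open ≡-Reasoning

[m*d+r]%d≡r : ∀ m {d r} .{{_ : NonZero d}} → r < d → (m * d + r) % d ≡ r
[m*d+r]%d≡r m {d} {r} r<d = trans (%-remove-+ˡ r (divides-refl m)) (m<n⇒m%n≡m r<d)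

*-+-injective : ∀ {d a b r s} .{{_ : NonZero d}} → r < d → s < d →
                a * d + r ≡ b * d + s → a ≡ b × r ≡ s
*-+-injective {a = a} {b} r<d s<d eq =
  trans (sym ([m*d+r]/d≡m a r<d)) (trans (cong (_/ _) eq) ([m*d+r]/d≡m b s<d)) ,
  trans (sym ([m*d+r]%d≡r a r<d)) (trans (cong (_% _) eq) ([m*d+r]%d≡r b s<d))

carry : ∀ a {K V} → suc V ≡ K → suc (a * K + V) ≡ suc a * K
carry a {K} {V} 1+V≡K =
  trans (sym (+-suc (a * K) V)) (trans (cong (a * K +_) 1+V≡K) (+-comm (a * K) K))

module Digits (k : ℕ) {{_ : NonZero k}} where

  val : ∀ n → (Fin n → ℕ) → ℕ
  val zero    e = 0
  val (suc n) e = e zero * k ^ n + val n (e ∘ suc)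

  digits : ∀ n → ℕ → Fin n → ℕ
  digits n x i = digit k n (toℕ i) x

  Bounded : ∀ {n} → (Fin n → ℕ) → Set
  Bounded e = ∀ i → e i < k

  digits-bounded : ∀ n x → Bounded (digits n x)
  digits-bounded n x i = m%n<n _ k

  val-cong : ∀ n {e e′ : Fin n → ℕ} → (∀ i → e i ≡ e′ i) → val n e ≡ val n e′
  val-cong zero    e≗e′ = refl
  val-cong (suc n) e≗e′ = cong₂ (λ a b → a * k ^ n + b) (e≗e′ zero) (val-cong n (e≗e′ ∘ suc))

  val-zeros : ∀ n {e : Fin n → ℕ} → (∀ i → e i ≡ 0) → val n e ≡ 0
  val-zeros zero    zeros = refl
  val-zeros (suc n) zeros = cong₂ (λ a b → a * k ^ n + b) (zeros zero) (val-zeros n (zeros ∘ suc))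

  val-< : ∀ n {e : Fin n → ℕ} → Bounded e → val n e < k ^ n
  val-< zero    _       = z<s
  val-< (suc n) {e} e<k =
    <-≤-trans (m*n+o<[1+m]*n (e zero) (val-< n (e<k ∘ suc))) (*-monoˡ-≤ (k ^ n) (e<k zero))

  val-sumTo : ∀ n (e : ℕ → ℕ) → val n (e ∘ toℕ) ≡ sumTo n (λ i → e i * k ^ (n ∸ suc i))
  val-sumTo zero    e = refl
  val-sumTo (suc n) e = begin
    e 0 * k ^ n + val n (e ∘ suc ∘ toℕ)
      ≡⟨ cong (e 0 * k ^ n +_) (val-sumTo n (e ∘ suc)) ⟩
    e 0 * k ^ n + sumTo n (λ i → e (suc i) * k ^ (n ∸ suc i))
      ≡⟨ sumTo-unfoldˡ (λ i → e i * k ^ (n ∸ i)) n ⟨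
    sumTo (suc n) (λ i → e i * k ^ (n ∸ i)) ∎
    where open ≡-Reasoning

  digit-leading : ∀ {n a y} → a < k → y < k ^ n → digit k (suc n) 0 (a * k ^ n + y) ≡ a
  digit-leading {n} {a} a<k y<kⁿ = trans (cong (_% k) ([m*d+r]/d≡m a y<kⁿ)) (m<n⇒m%n≡m a<k)
    where instance _ = m^n≢0 k n

  digit-+-multiple : ∀ {n p} a y → p < n → digit k n p (a * k ^ n + y) ≡ digit k n p y
  digit-+-multiple {n} {p} a y p<n = begin
    (a * k ^ n + y) / k ^ t % k         ≡⟨ m%[n*o]/o≡m/o%n _ k (k ^ t) ⟨
    (a * k ^ n + y) % k ^ suc t / k ^ t ≡⟨ cong (_/ k ^ t) (%-remove-+ˡ y k^[1+t]∣a*kⁿ) ⟩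
    y % k ^ suc t / k ^ t               ≡⟨ m%[n*o]/o≡m/o%n y k (k ^ t) ⟩
    y / k ^ t % k                       ∎
    where
    open ≡-Reasoning
    t = n ∸ suc p
    instance
      _ = m^n≢0 k t
      _ = m^n≢0 k (suc t)
    k^[1+t]∣a*kⁿ : k ^ suc t ∣ a * k ^ n
    k^[1+t]∣a*kⁿ = divides (a * k ^ p) $ begin
      a * k ^ n               ≡⟨ cong (λ e → a * k ^ e) (trans (+-suc p t) (m+[n∸m]≡n p<n)) ⟨
      a * k ^ (p + suc t)     ≡⟨ cong (a *_) (^-distribˡ-+-* k p (suc t)) ⟩
      a * (k ^ p * k ^ suc t) ≡⟨ *-assoc a _ _ ⟨
      a * k ^ p * k ^ suc t   ∎

  digits-val : ∀ n {e : Fin n → ℕ} → Bounded e → ∀ i → digits n (val n e) i ≡ e i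
  digits-val (suc n)     e<k zero    = digit-leading {n} (e<k zero) (val-< n (e<k ∘ suc))
  digits-val (suc n) {e} e<k (suc i) =
    trans (digit-+-multiple {n} (e zero) _ (toℕ<n i)) (digits-val n (e<k ∘ suc) i)

  val-digits : ∀ n x → val n (digits n x) ≡ _%_ x (k ^ n) {{m^n≢0 k n}}
  val-digits zero    x = sym (n%1≡0 x)
  val-digits (suc n) x = begin
    x / k ^ n % k * k ^ n + val n (digits n x)
      ≡⟨ cong (x / k ^ n % k * k ^ n +_) (val-digits n x) ⟩
    x / k ^ n % k * k ^ n + x % k ^ n
      ≡⟨ cong (_+ x % k ^ n) (m%n*o≡m*o%[n*o] (x / k ^ n) k (k ^ n)) ⟩
    x / k ^ n * k ^ n % k ^ suc n + x % k ^ n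
      ≡⟨ [m*n+o]%[p*n]≡[m*n]%[p*n]+o (x / k ^ n) k (m%n<n x (k ^ n)) ⟨
    (x / k ^ n * k ^ n + x % k ^ n) % k ^ suc n
      ≡⟨ cong (_% k ^ suc n) (trans (+-comm _ (x % k ^ n)) (sym (m≡m%n+[m/n]*n x (k ^ n)))) ⟩
    x % k ^ suc n ∎
    where
    open ≡-Reasoning
    instance
      _ = m^n≢0 k n
      _ = m^n≢0 k (suc n)

  val-digits-< : ∀ n {x} → x < k ^ n → val n (digits n x) ≡ x
  val-digits-< n x<kⁿ = trans (val-digits n _) (m<n⇒m%n≡m x<kⁿ)
    where instance _ = m^n≢0 k n

  val-<-lex : ∀ n {e e′ : Fin n → ℕ} → Bounded e → (p : Fin n) →
              (∀ {q} → q Fin.< p → e q ≡ e′ q) → e p < e′ p → val n e < val n e′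
  val-<-lex (suc n) {e} {e′} e<k zero _ e₀<e′₀ = begin-strict
    val (suc n) e         <⟨ m*n+o<[1+m]*n (e zero) (val-< n (e<k ∘ suc)) ⟩
    suc (e zero) * k ^ n  ≤⟨ *-monoˡ-≤ (k ^ n) e₀<e′₀ ⟩
    e′ zero * k ^ n       ≤⟨ m≤m+n _ _ ⟩
    val (suc n) e′        ∎
    where open ≤-Reasoning
  val-<-lex (suc n) e<k (suc p) agree eₚ<e′ₚ =
    +-mono-≤-< (≤-reflexive (cong (_* k ^ n) (agree z<s)))
               (val-<-lex n (e<k ∘ suc) p (agree ∘ s<s) eₚ<e′ₚ)

  val-<-first-difference : ∀ n {e e′ : Fin n → ℕ} → Bounded e → Bounded e′ → (p : Fin n) →
    (∀ {q} → q Fin.< p → e q ≡ e′ q) → e p ≢ e′ p → val n e < val n e′ ⇔ e p < e′ p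
  val-<-first-difference n {e} {e′} e<k e′<k p agree differ = mk⇔ to (val-<-lex n e<k p agree)
    where
    to : val n e < val n e′ → e p < e′ p
    to val< with <-cmp (e p) (e′ p)
    ... | tri< eₚ<e′ₚ _ _ = eₚ<e′ₚ
    ... | tri≈ _ eₚ≡e′ₚ _ = contradiction eₚ≡e′ₚ differ
    ... | tri> _ _ eₚ>e′ₚ = contradiction val< (<-asym (val-<-lex n e′<k p (sym ∘ agree) eₚ>e′ₚ))

  LastNonZero : ∀ {n} → (Fin n → ℕ) → Fin n → Set
  LastNonZero e s = e s ≢ 0 × (∀ {i} → s Fin.< i → e i ≡ 0)

  lastNonZero : ∀ {n} (e : Fin n → ℕ) → ¬ (∀ i → e i ≡ 0) → ∃ (LastNonZero e)
  lastNonZero {zero}  e notZeros = contradiction (λ ()) notZeros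
  lastNonZero {suc n} e notZeros with all? (λ i → e (suc i) ≟ 0)
  ... | yes tailZeros =
    zero ,
    (λ e₀≡0 → notZeros λ { zero → e₀≡0 ; (suc i) → tailZeros i }) ,
    λ { {suc i} _ → tailZeros i }
  ... | no ¬tailZeros with lastNonZero (e ∘ suc) ¬tailZeros
  ...   | s , nonZero , zeros = suc s , nonZero , λ { {suc i} s<i → zeros (s<s⁻¹ s<i) }

  lastNonZero-digits : ∀ n {x} → x ≢ 0 → x < k ^ n → ∃ (LastNonZero (digits n x))
  lastNonZero-digits n x≢0 x<kⁿ =
    lastNonZero (digits n _) λ zeros → x≢0 (trans (sym (val-digits-< n x<kⁿ)) (val-zeros n zeros))

  borrow : ∀ {n} → Fin n → (Fin n → ℕ) → Fin n → ℕ
  borrow zero    e zero    = e zero ∸ 1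
  borrow zero    e (suc i) = k ∸ 1
  borrow (suc s) e zero    = e zero
  borrow (suc s) e (suc i) = borrow s (e ∘ suc) i

  borrow-bounded : ∀ {n} (s : Fin n) {e} → Bounded e → Bounded (borrow s e)
  borrow-bounded zero    e<k zero    = ≤-<-trans (m∸n≤m _ 1) (e<k zero)
  borrow-bounded zero    e<k (suc i) = ∸-monoʳ-< z<s (n≢0⇒n>0 (≢-nonZero⁻¹ k))
  borrow-bounded (suc s) e<k zero    = e<k zero
  borrow-bounded (suc s) e<k (suc i) = borrow-bounded s (e<k ∘ suc) i

  borrow-below : ∀ {n} (s : Fin n) e {i} → i Fin.< s → borrow s e i ≡ e i
  borrow-below (suc s) e {zero}  _         = refl
  borrow-below (suc s) e {suc i} (s<s i<s) = borrow-below s (e ∘ suc) i<s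

  borrow-at : ∀ {n} (s : Fin n) e → borrow s e s ≡ e s ∸ 1
  borrow-at zero    e = refl
  borrow-at (suc s) e = borrow-at s (e ∘ suc)

  borrow-above : ∀ {n} (s : Fin n) e {i} → s Fin.< i → borrow s e i ≡ k ∸ 1
  borrow-above zero    e {suc i} _         = refl
  borrow-above (suc s) e {suc i} (s<s s<i) = borrow-above s (e ∘ suc) s<i

  suc-val-maximal : ∀ n → suc (val n (λ _ → k ∸ 1)) ≡ k ^ n
  suc-val-maximal zero    = refl
  suc-val-maximal (suc n) =
    trans (carry (k ∸ 1) (suc-val-maximal n))
          (cong (_* k ^ n) (m+[n∸m]≡n (n≢0⇒n>0 (≢-nonZero⁻¹ k))))

  suc-val-borrow : ∀ n {e : Fin n → ℕ} (s : Fin n) → LastNonZero e s →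
                   suc (val n (borrow s e)) ≡ val n e
  suc-val-borrow (suc n) {e} zero (e₀≢0 , zeros) = begin
    suc ((e zero ∸ 1) * k ^ n + val n (λ _ → k ∸ 1))
      ≡⟨ carry (e zero ∸ 1) (suc-val-maximal n) ⟩
    suc (e zero ∸ 1) * k ^ n
      ≡⟨ cong (_* k ^ n) (m+[n∸m]≡n (n≢0⇒n>0 e₀≢0)) ⟩
    e zero * k ^ n
      ≡⟨ +-identityʳ _ ⟨
    e zero * k ^ n + 0
      ≡⟨ cong (e zero * k ^ n +_) (val-zeros n λ _ → zeros z<s) ⟨
    val (suc n) e ∎
    where open ≡-Reasoning
  suc-val-borrow (suc n) {e} (suc s) (eₛ≢0 , zeros) = begin
    suc (e zero * k ^ n + val n (borrow s (e ∘ suc)))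
      ≡⟨ +-suc _ _ ⟨
    e zero * k ^ n + suc (val n (borrow s (e ∘ suc)))
      ≡⟨ cong (e zero * k ^ n +_) (suc-val-borrow n s (eₛ≢0 , zeros ∘ s<s)) ⟩
    val (suc n) e ∎
    where open ≡-Reasoning

  borrow-drops : ∀ {n} {e : Fin n → ℕ} {s} → LastNonZero e s → borrow s e s < e s
  borrow-drops {e = e} {s} (eₛ≢0 , _) =
    subst (_< e s) (sym (borrow-at s e)) (∸-monoʳ-< z<s (n≢0⇒n>0 eₛ≢0))

  borrow-rises : ∀ {n} {e : Fin n → ℕ} {s i} → 2 ≤ k → LastNonZero e s → s Fin.< i →
                 e i < borrow s e i
  borrow-rises {e = e} {s} 2≤k (_ , zeros) s<i =
    subst₂ _<_ (sym (zeros s<i)) (sym (borrow-above s e s<i)) (m<n⇒0<n∸m 2≤k)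

  borrow-changes : ∀ {n} {e : Fin n → ℕ} {s i} → 2 ≤ k → LastNonZero e s → s Fin.≤ i →
                   e i ≢ borrow s e i
  borrow-changes {s = s} {i} 2≤k lnz s≤i with Finₚ.<-cmp s i
  ... | tri< s<i _ _  = <⇒≢ (borrow-rises 2≤k lnz s<i)
  ... | tri≈ _ refl _ = >⇒≢ (borrow-drops lnz)
  ... | tri> _ _ i<s  = contradiction s≤i (<⇒≱ i<s)

  borrow-rises⇔ : ∀ {n} {e : Fin n → ℕ} {s i} → 2 ≤ k → LastNonZero e s → s Fin.≤ i →
                  e i < borrow s e i ⇔ s Fin.< i
  borrow-rises⇔ {s = s} {i} 2≤k lnz s≤i with Finₚ.<-cmp s i
  ... | tri< s<i _ _  = mk⇔ (λ _ → s<i) (borrow-rises 2≤k lnz)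
  ... | tri≈ _ refl _ = mk⇔ (λ rise → contradiction rise (<-asym (borrow-drops lnz)))
                            (λ s<s → contradiction s<s (<-irrefl refl))
  ... | tri> _ _ i<s  = contradiction s≤i (<⇒≱ i<s)

module Firing (k : ℕ) {{_ : NonZero k}} (n : ℕ) where
  open Digits k

  -- The fired positions are listed most recent first; vertex v of a layer holds exactly
  -- the chips whose address is v.
  address : List ℕ → ℕ → ℕ
  address []       c = 0
  address (p ∷ ps) c = address ps c * k + digit k n p c

  chips : List ℕ
  chips = upTo (k ^ n)

  vertex : List ℕ → ℕ → List ℕ
  vertex ps v = filter (λ c → address ps c ≟ v) chips

  layer : List ℕ → Layer
  layer ps = applyUpTo (vertex ps) (k ^ length ps)

  vertex-child : ∀ p ps v {j} → j < k →
    filter (λ c → digit k n p c ≟ j) (vertex ps v) ≡ vertex (p ∷ ps) (v * k + j)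
  vertex-child p ps v {j} j<k =
    trans (filter-filter (λ c → digit k n p c ≟ j) (λ c → address ps c ≟ v) chips)
          (filter-≐ _ (λ c → address (p ∷ ps) c ≟ v * k + j) child⇔ chips)
    where
    child⇔ : (λ c → address ps c ≡ v × digit k n p c ≡ j) ≐
             (λ c → address (p ∷ ps) c ≡ v * k + j)
    child⇔ = (λ { (refl , refl) → refl }) , *-+-injective (m%n<n _ k) j<k

  fireLayer-layer : ∀ p ps → fireLayer k n p (layer ps) ≡ layer (p ∷ ps)
  fireLayer-layer p ps = begin
    concat (map children (applyUpTo (vertex ps) N))
      ≡⟨ cong concat (map-applyUpTo (vertex ps) children N) ⟩
    concat (applyUpTo (children ∘ vertex ps) N)
      ≡⟨ cong concat (applyUpTo-cong N λ {v} _ →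
           trans (map-upTo _ k) (applyUpTo-cong k (vertex-child p ps v))) ⟩
    concat (applyUpTo (λ v → applyUpTo (λ j → vertex (p ∷ ps) (v * k + j)) k) N)
      ≡⟨ applyUpTo-blocks (vertex (p ∷ ps)) k N ⟨
    applyUpTo (vertex (p ∷ ps)) (N * k)
      ≡⟨ cong (applyUpTo (vertex (p ∷ ps))) (*-comm N k) ⟩
    layer (p ∷ ps) ∎
    where
    open ≡-Reasoning
    N = k ^ length ps
    children : List ℕ → Layer
    children vs = map (λ j → filter (λ c → digit k n p c ≟ j) vs) (upTo k)

  foldl-fireLayer : ∀ {A : Set} (pos : A → ℕ) xs ps →
    foldl (λ vs x → fireLayer k n (pos x) vs) (layer ps) xs ≡ layer (map pos xs ʳ++ ps)
  foldl-fireLayer pos []       ps = refl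
  foldl-fireLayer pos (x ∷ xs) ps =
    trans (cong (λ vs → foldl _ vs xs) (fireLayer-layer (pos x) ps))
          (foldl-fireLayer pos xs (pos x ∷ ps))

  layer-[] : layer [] ≡ [ chips ]
  layer-[] = cong [_] (filter-all (λ c → 0 ≟ 0) (All.universal (λ _ → refl) chips))

  address-tabulate : ∀ {m} (g : Fin m → ℕ) ps c →
    address (tabulate g ʳ++ ps) c ≡ address ps c * k ^ m + val m (λ i → digit k n (g i) c)
  address-tabulate {zero}  g ps c = sym (trans (+-identityʳ _) (*-identityʳ _))
  address-tabulate {suc m} g ps c = begin
    address (tabulate (g ∘ suc) ʳ++ g zero ∷ ps) c
      ≡⟨ address-tabulate (g ∘ suc) (g zero ∷ ps) c ⟩
    (address ps c * k + d₀) * k ^ m + V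
      ≡⟨ solve 5 (λ a k d K V → (a :* k :+ d) :* K :+ V := a :* (k :* K) :+ (d :* K :+ V)) refl
               (address ps c) k d₀ (k ^ m) V ⟩
    address ps c * k ^ suc m + (d₀ * k ^ m + V) ∎
    where
    open ≡-Reasoning
    open +-*-Solver
    d₀ = digit k n (g zero) c
    V = val m (λ i → digit k n (g (suc i)) c)

module Strategy (k : ℕ) {{_ : NonZero k}} {n : ℕ} (w : Perm n) where
  open Digits k
  open Firing k n

  permuteDigits : (Fin n → Fin n) → ℕ → ℕ
  permuteDigits f x = val n (digits n x ∘ f)

  permuteDigits-val : ∀ f {e} → Bounded e → permuteDigits f (val n e) ≡ val n (e ∘ f)
  permuteDigits-val f e<k = val-cong n (digits-val n e<k ∘ f)

  permuteDigits-id : ∀ {f x} → (∀ i → f i ≡ i) → x < k ^ n → permuteDigits f x ≡ x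
  permuteDigits-id {x = x} f≗id x<kⁿ =
    trans (val-cong n (cong (digits n x) ∘ f≗id)) (val-digits-< n x<kⁿ)

  leafOf : ℕ → ℕ
  leafOf = permuteDigits (w ⟨$⟩ʳ_)

  chipAt : ℕ → ℕ
  chipAt = permuteDigits (w ⟨$⟩ˡ_)

  leafOf-chipAt : ∀ {v} → v < k ^ n → leafOf (chipAt v) ≡ v
  leafOf-chipAt {v} v<kⁿ = trans (permuteDigits-val (w ⟨$⟩ʳ_) (digits-bounded n v ∘ (w ⟨$⟩ˡ_)))
                                 (permuteDigits-id (λ _ → inverseˡ w) v<kⁿ)

  chipAt-leafOf : ∀ {c} → c < k ^ n → chipAt (leafOf c) ≡ c
  chipAt-leafOf {c} c<kⁿ = trans (permuteDigits-val (w ⟨$⟩ˡ_) (digits-bounded n c ∘ (w ⟨$⟩ʳ_)))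
                                 (permuteDigits-id (λ _ → inverseʳ w) c<kⁿ)

  firings : List ℕ
  firings = tabulate (toℕ ∘ (w ⟨$⟩ʳ_)) ʳ++ []

  leaf : ∀ {v} → v < k ^ n → vertex firings v ≡ [ chipAt v ]
  leaf {v} v<kⁿ =
    filter-upTo-unique (λ c → address firings c ≟ v) (k ^ n)
                       (val-< n (digits-bounded n v ∘ (w ⟨$⟩ˡ_))) reaches
    where
    reaches : ∀ {c} → c < k ^ n → address firings c ≡ v ⇔ c ≡ chipAt v
    reaches {c} c<kⁿ = mk⇔
      (λ address≡v → trans (sym (chipAt-leafOf c<kⁿ))
                           (cong chipAt (trans (sym address≡leafOf) address≡v)))
      (λ c≡chipAt → trans address≡leafOf (trans (cong leafOf c≡chipAt) (leafOf-chipAt v<kⁿ)))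
      where
      address≡leafOf : address firings c ≡ leafOf c
      address≡leafOf = address-tabulate (toℕ ∘ (w ⟨$⟩ʳ_)) [] c

  config≡applyUpTo-chipAt : config k n w ≡ applyUpTo chipAt (k ^ n)
  config≡applyUpTo-chipAt = begin
    concat (foldl fire [ chips ] (allFin n))
      ≡⟨ cong (λ vs → concat (foldl fire vs (allFin n))) layer-[] ⟨
    concat (foldl fire (layer []) (allFin n))
      ≡⟨ cong concat (foldl-fireLayer (toℕ ∘ (w ⟨$⟩ʳ_)) (allFin n) []) ⟩
    concat (layer (map (toℕ ∘ (w ⟨$⟩ʳ_)) (allFin n) ʳ++ []))
      ≡⟨ cong (λ ps → concat (layer (ps ʳ++ []))) (map-tabulate id (toℕ ∘ (w ⟨$⟩ʳ_))) ⟩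
    concat (applyUpTo (vertex firings) (k ^ length firings))
      ≡⟨ cong (λ L → concat (applyUpTo (vertex firings) (k ^ L))) length-firings ⟩
    concat (applyUpTo (vertex firings) (k ^ n))
      ≡⟨ cong concat (applyUpTo-cong (k ^ n) leaf) ⟩
    concat (applyUpTo ([_] ∘ chipAt) (k ^ n))
      ≡⟨ cong concat (map-applyUpTo chipAt [_] (k ^ n)) ⟨
    concat (map [_] (applyUpTo chipAt (k ^ n)))
      ≡⟨ concat-map-[_] (applyUpTo chipAt (k ^ n)) ⟩
    applyUpTo chipAt (k ^ n) ∎
    where
    open ≡-Reasoning
    fire : Layer → Fin n → Layer
    fire vs i = fireLayer k n (toℕ (w ⟨$⟩ʳ i)) vs
    length-firings : length firings ≡ n
    length-firings = trans (length-ʳ++ (tabulate (toℕ ∘ (w ⟨$⟩ʳ_))) {[]})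
                           (trans (+-identityʳ _) (length-tabulate (toℕ ∘ (w ⟨$⟩ʳ_))))

  InversionFrom : Fin n → Set
  InversionFrom s = ∃ λ j → s Fin.< j × w ⟨$⟩ʳ j Fin.< w ⟨$⟩ʳ s

  lehmer⇔ : ∀ s → 0 < lehmer w s ⇔ InversionFrom s
  lehmer⇔ s = mk⇔
    (Any.satisfied ∘ filter-nonempty⇒Any later-and-smaller? (allFin n))
    (λ (j , s<j , wⱼ<wₛ) → filter-some later-and-smaller? (lose (∈-allFin j) (s<j , wⱼ<wₛ)))
    where
    later-and-smaller? = λ j → (s Fin.<? j) ×-dec ((w ⟨$⟩ʳ j) Fin.<? (w ⟨$⟩ʳ s))

  firstPositionFrom : ∀ s →
    ∃ λ p → s Fin.≤ w ⟨$⟩ˡ p × (∀ {q} → q Fin.< p → w ⟨$⟩ˡ q Fin.< s)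
  firstPositionFrom s
    with ¬∀⟶∃¬-smallest n (λ p → w ⟨$⟩ˡ p Fin.< s) (λ p → (w ⟨$⟩ˡ p) Fin.<? s)
           (λ allBefore → Finₚ.<-irrefl (inverseˡ w) (allBefore (w ⟨$⟩ʳ s)))
  ... | p , ¬before , earlierBefore =
    p , ≮⇒≥ ¬before ,
    λ q<p → subst (λ q → w ⟨$⟩ˡ q Fin.< s) (inject-fromℕ< q<p) (earlierBefore (fromℕ< q<p))
    where
    inject-fromℕ< : ∀ {q} (q<p : toℕ q < toℕ p) → inject {i = p} (fromℕ< q<p) ≡ q
    inject-fromℕ< q<p = toℕ-injective (trans (toℕ-inject (fromℕ< q<p)) (toℕ-fromℕ< q<p))

  firstPosition-inversion⇔ : ∀ {s p} → s Fin.≤ w ⟨$⟩ˡ p →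
    (∀ {q} → q Fin.< p → w ⟨$⟩ˡ q Fin.< s) → s Fin.< w ⟨$⟩ˡ p ⇔ InversionFrom s
  firstPosition-inversion⇔ {s} {p} s≤i before = mk⇔ to from
    where
    to : s Fin.< w ⟨$⟩ˡ p → InversionFrom s
    to s<i =
      w ⟨$⟩ˡ p , s<i , subst (Fin._< w ⟨$⟩ʳ s) (sym (inverseʳ w)) (Finₚ.≤∧≢⇒< p≤wₛ p≢wₛ)
      where
      p≤wₛ : p Fin.≤ w ⟨$⟩ʳ s
      p≤wₛ = ≮⇒≥ (λ wₛ<p → Finₚ.<-irrefl (inverseˡ w) (before wₛ<p))
      p≢wₛ : p ≢ w ⟨$⟩ʳ s
      p≢wₛ p≡wₛ = Finₚ.<-irrefl (trans (sym (inverseˡ w)) (cong (w ⟨$⟩ˡ_) (sym p≡wₛ))) s<i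
    from : InversionFrom s → s Fin.< w ⟨$⟩ˡ p
    from (j , s<j , wⱼ<wₛ) = Finₚ.≤∧≢⇒< s≤i s≢i
      where
      s≢i : s ≢ w ⟨$⟩ˡ p
      s≢i s≡i = Finₚ.<-asym s<j
        (subst (Fin._< s) (inverseˡ w) (before (subst (w ⟨$⟩ʳ j Fin.<_) wₛ≡p wⱼ<wₛ)))
        where
        wₛ≡p : w ⟨$⟩ʳ s ≡ p
        wₛ≡p = trans (cong (w ⟨$⟩ʳ_) s≡i) (inverseʳ w)

  descent-criterion : 2 ≤ k → ∀ {e s} → Bounded e → LastNonZero e s →
    val n (e ∘ (w ⟨$⟩ˡ_)) < val n (borrow s e ∘ (w ⟨$⟩ˡ_)) ⇔ InversionFrom s
  descent-criterion 2≤k {e} {s} e<k lnz with firstPositionFrom s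
  ... | p , s≤i , before =
    ⇔-trans (val-<-first-difference n (e<k ∘ (w ⟨$⟩ˡ_)) (borrow-bounded s e<k ∘ (w ⟨$⟩ˡ_)) p
               (λ q<p → sym (borrow-below s e (before q<p))) (borrow-changes 2≤k lnz s≤i))
    (⇔-trans (borrow-rises⇔ 2≤k lnz s≤i)
             (firstPosition-inversion⇔ s≤i before))

module Representation (k : ℕ) {{_ : NonZero k}} (n : ℕ) where
  open Digits k

  SumRep : ℕ → ℕ → Set
  SumRep m s = Σ (ℕ → ℕ) λ d → (∀ i → i < s → d i < k) × (1 ≤ d s) × (d s < k) ×
                 (m ≡ sumTo (suc s) (λ i → d i * k ^ (n ∸ suc i)))

  sumRep⇔ : ∀ {m} (s : Fin n) → SumRep m (toℕ s) ⇔ (m < k ^ n × LastNonZero (digits n m) s)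
  sumRep⇔ {m} s = mk⇔ to from
    where
    to : SumRep m (toℕ s) → m < k ^ n × LastNonZero (digits n m) s
    to (d , d<k , 1≤dₛ , dₛ<k , m≡sum) =
      subst (_< k ^ n) (sym m≡val) (val-< n (d̂<k ∘ toℕ)) ,
      (λ mₛ≡0 → >⇒≢ 1≤dₛ (trans (sym (truncate-≤ {toℕ s} {d} ≤-refl))
                                (trans (sym (digits-m s)) mₛ≡0))) ,
      (λ s<i → trans (digits-m _) (truncate-> s<i))
      where
      d̂ = truncate (toℕ s) d
      d̂<k : ∀ i → d̂ i < k
      d̂<k i with i ≤? toℕ s
      ... | no _ = n≢0⇒n>0 (≢-nonZero⁻¹ k)
      ... | yes i≤s with m≤n⇒m<n∨m≡n i≤s
      ...   | inj₁ i<s  = d<k i i<s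
      ...   | inj₂ refl = dₛ<k
      m≡val : m ≡ val n (d̂ ∘ toℕ)
      m≡val = begin
        m
          ≡⟨ m≡sum ⟩
        sumTo (suc (toℕ s)) (λ i → d i * k ^ (n ∸ suc i))
          ≡⟨ sumTo-cong (suc (toℕ s)) (cong (_* _) ∘ sym ∘ truncate-≤ ∘ s≤s⁻¹) ⟩
        sumTo (suc (toℕ s)) (λ i → d̂ i * k ^ (n ∸ suc i))
          ≡⟨ sumTo-vanishing-tail (toℕ<n s) (λ s<i _ → cong (_* _) (truncate-> s<i)) ⟨
        sumTo n (λ i → d̂ i * k ^ (n ∸ suc i))
          ≡⟨ val-sumTo n d̂ ⟨
        val n (d̂ ∘ toℕ) ∎
        where open ≡-Reasoning
      digits-m : ∀ i → digits n m i ≡ d̂ (toℕ i)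
      digits-m i = trans (cong (λ x → digits n x i) m≡val) (digits-val n (d̂<k ∘ toℕ) i)
    from : m < k ^ n × LastNonZero (digits n m) s → SumRep m (toℕ s)
    from (m<kⁿ , mₛ≢0 , zeros) = d , (λ i _ → m%n<n _ k) , n≢0⇒n>0 mₛ≢0 , m%n<n _ k , m≡sum
      where
      d : ℕ → ℕ
      d i = digit k n i m
      vanish : ∀ {i} → toℕ s < i → i < n → d i * k ^ (n ∸ suc i) ≡ 0
      vanish s<i i<n = cong (_* _) (trans (cong d (sym (toℕ-fromℕ< i<n)))
                                          (zeros (subst (toℕ s <_) (sym (toℕ-fromℕ< i<n)) s<i)))
      m≡sum : m ≡ sumTo (suc (toℕ s)) (λ i → d i * k ^ (n ∸ suc i))
      m≡sum = begin
        m                                     ≡⟨ val-digits-< n m<kⁿ ⟨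
        val n (d ∘ toℕ)                       ≡⟨ val-sumTo n d ⟩
        sumTo n (λ i → d i * k ^ (n ∸ suc i)) ≡⟨ sumTo-vanishing-tail (toℕ<n s) vanish ⟩
        sumTo (suc (toℕ s)) (λ i → d i * k ^ (n ∸ suc i)) ∎
        where open ≡-Reasoning

module Descents (k : ℕ) {{_ : NonZero k}} (2≤k : 2 ≤ k) {n : ℕ} (w : Perm n) where
  open Digits k
  open Strategy k w
  open Representation k n

  FallsAt : ℕ → Set
  FallsAt m = ∃ λ m₀ → m ≡ suc m₀ × m < k ^ n × chipAt m < chipAt m₀

  suc-val-borrow-digits : ∀ {m s} → m < k ^ n → LastNonZero (digits n m) s →
                          suc (val n (borrow s (digits n m))) ≡ m
  suc-val-borrow-digits {s = s} m<kⁿ lnz = trans (suc-val-borrow n s lnz) (val-digits-< n m<kⁿ)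

  chipAt-falls⇔inversion : ∀ {m s} → m < k ^ n → LastNonZero (digits n m) s →
    chipAt m < chipAt (val n (borrow s (digits n m))) ⇔ InversionFrom s
  chipAt-falls⇔inversion {m} {s} m<kⁿ lnz =
    subst (λ x → chipAt m < x ⇔ InversionFrom s)
          (sym (permuteDigits-val (w ⟨$⟩ˡ_) (borrow-bounded s (digits-bounded n m))))
          (descent-criterion 2≤k (digits-bounded n m) lnz)

  fallsAt⇔ : ∀ {m} → FallsAt m ⇔ (∃ λ s → 0 < lehmer w s × SumRep m (toℕ s))
  fallsAt⇔ {m} = mk⇔ to from
    where
    to : FallsAt m → ∃ λ s → 0 < lehmer w s × SumRep m (toℕ s)
    to (m₀ , refl , m<kⁿ , falls) with lastNonZero-digits n (λ ()) m<kⁿ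
    ... | s , lnz =
      s ,
      Equivalence.from (lehmer⇔ s) (Equivalence.to (chipAt-falls⇔inversion m<kⁿ lnz)
        (subst (λ x → chipAt m < chipAt x) m₀≡val-borrow falls)) ,
      Equivalence.from (sumRep⇔ s) (m<kⁿ , lnz)
      where
      m₀≡val-borrow : m₀ ≡ val n (borrow s (digits n m))
      m₀≡val-borrow = sym (suc-injective (suc-val-borrow-digits m<kⁿ lnz))
    from : (∃ λ s → 0 < lehmer w s × SumRep m (toℕ s)) → FallsAt m
    from (s , 0<lehmer , rep) with Equivalence.to (sumRep⇔ s) rep
    ... | m<kⁿ , lnz =
      val n (borrow s (digits n m)) , sym (suc-val-borrow-digits m<kⁿ lnz) , m<kⁿ ,
      Equivalence.from (chipAt-falls⇔inversion m<kⁿ lnz) (Equivalence.to (lehmer⇔ s) 0<lehmer)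

theorem5p1 : (k : ℕ) → (hk : 2 ≤ k) → (n : ℕ) → (w : Perm n) → (m : ℕ) →
    IsDescent (config k {{2≤⇒nonZero hk}} n w) m ⇔
      (Σ ℕ λ s → Σ (s < n) λ s<n → (0 < lehmer w (fromℕ< s<n)) ×
        (Σ (ℕ → ℕ) λ d → (∀ i → i < s → d i < k) × (1 ≤ d s) × (d s < k) ×
          (m ≡ sumTo (suc s) (λ i → d i * k ^ (n ∸ suc i)))))
theorem5p1 k hk n w m = begin
  IsDescent (config k n w) m
    ≡⟨ cong (λ xs → IsDescent xs m) config≡applyUpTo-chipAt ⟩
  IsDescent (applyUpTo chipAt (k ^ n)) m
    ≈⟨ IsDescent-applyUpTo chipAt (k ^ n) m ⟩
  FallsAt m
    ≈⟨ fallsAt⇔ ⟩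
  (∃ λ s → 0 < lehmer w s × SumRep m (toℕ s))
    ≈⟨ ∃-Fin⇔∃-< (λ s → 0 < lehmer w s) (SumRep m) ⟨
  _ ∎
  where
  instance _ = 2≤⇒nonZero hk
  open Strategy k w
  open Representation k n
  open Descents k hk w
  open SetoidReasoning (⇔-setoid 0ℓ)
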